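{- Let $n$ be a positive integer. The set $$\{\gamma(\nabla B^{2(n-k)-1}_{2n-1,-k}): k\in\{1,\dots,n-1\}\}\cup\{\gamma(\nabla(1)_{2n-1})\}$$ is a basis of $\mathcal{HPT}(n)$. Here, for all $k\in\{1,\dots,n-1\}$, $$\gamma(\nabla B^{2(n-k)-1}_{2n-1,-k})=\left(\binom{ -k+j-i+n-1}{2(n-k)-i}\bmod 2\right)_{1\le j\le i\le n},$$ and $\gamma(\nabla(1)_{2n-1})$ is the generalized Pascal triangle whose left side and right side both equal $(1)\cdot(0)_{n-1}$.
   Context: Binomial coefficients $\binom{a}{b}$ are defined for all integers $a,b$ by $\binom{a}{0}=1$, $\binom{0}{b}=0$ for $b>0$, and $\binom{a}{b}=\binom{a-1}{b-1}+\binom{a-1}{b}$ for all $a,b\in\mathbb{Z}$. A binary Steinhaus triangle of size $N$ is an array $(a_{i,j})_{1\le i\le j\le N}$ of elements of $\{0,1\}$ with $a_{i,j}\equiv a_{i-1,j-1}+a_{i-1,j}\pmod 2$ for $2\le i\le j\le N$. $\nabla S$ is the triangle with first row $S$. A generalized Pascal triangle of size $n$ is an array $(a_{i,j})_{1\le j\le i\le n}$ of elements of $\{0,1\}$ with $a_{i,j}\equiv a_{i-1,j-1}+a_{i-1,j}\pmod 2$ for $2\le j<i\le n$. Its left side is $(a_{i,1})_{1\le i\le n}$ and its right side is $(a_{i,i})_{1\le i\le n}$. These form a vector space $\mathcal{PT}(n)$ over $\mathbb{Z}/2\mathbb{Z}$. The map $\gamma$ sends a Steinhaus triangle $(a_{i,j})$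 of size $2n-1$ to $(a_{i,n-1+j})_{1\le j\le i\le n}$. The reflection on $\mathcal{PT}(n)$ is $h'((a_{i,j}))=(a_{i,1-j+i})_{1\le j\le i\le n}$, and $\mathcal{HPT}(n)=\{\Delta: h'(\Delta)=\Delta\}$. $B^{k}_{N,l}=\left(\binom{l+j-1}{k}\bmod 2\right)_{1\le j\le N}$. $(x)_k$ is the constant sequence of length $k$ equal to $x$, and $\cdot$ is concatenation. -}

module Defs where

open import Data.Bool using (Bool; true; false; _xor_; _∧_)
open import Data.Nat as ℕ using (ℕ; zero; suc; _∸_; _≤_; _≡ᵇ_)
open import Data.Nat.DivMod using (_%_)
open import Data.Nat.Combinatorics using (_C_)
open import Data.Integer as ℤ using (ℤ; +_; -[1+_]; ∣_∣)
open import Data.Fin using (Fin; zero; suc; toℕ)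
open import Data.Product using (_×_; ∃)
open import Relation.Binary.PropositionalEquality using (_≡_)

-- Binomial coefficients on ℤ × ℤ (the unique solution of the paper's
-- recurrence): 0 for negative lower index, the usual nCk for a,b ≥ 0,
-- and binom(-(a+1), b) = (-1)^b * C(a+b, b).

binomℤ : ℤ → ℤ → ℤ
binomℤ a       -[1+ _ ] = + 0
binomℤ (+ a)   (+ b)    = + (a C b)
binomℤ -[1+ a ] (+ b)   = (ℤ.- (+ 1)) ℤ.^ b ℤ.* + ((a ℕ.+ b) C b)

binom2 : ℤ → ℤ → Bool
binom2 a b = (∣ binomℤ a b ∣ % 2) ≡ᵇ 1

-- Triangles are represented as functions (i j : ℕ) → Bool (1-based
-- indices); only the entries in the relevant index range matter.

Tri : Set
Tri = ℕ → ℕ → Bool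

Row : Set
Row = ℕ → Bool

nabla : Row → Tri
nabla S zero          j = S j
nabla S (suc zero)    j = S j
nabla S (suc (suc m)) j = nabla S (suc m) (j ∸ 1) xor nabla S (suc m) j

γ : ℕ → Tri → Tri
γ n T i j = T i ((n ∸ 1) ℕ.+ j)

-- B^k_{N,l} = (binom(l+j-1, k) mod 2)_{1≤j≤N}   (N only fixes the length)
B : ℕ → ℕ → ℤ → Row
B k N l j = binom2 ((l ℤ.+ + j) ℤ.- + 1) (+ k)

const : Bool → ℕ → Row
const x N j = x

IsPT : ℕ → Tri → Set
IsPT n t = ∀ i j → 2 ≤ j → suc j ≤ i → i ≤ n →
  t i j ≡ (t (i ∸ 1) (j ∸ 1) xor t (i ∸ 1) j)

h' : Tri → Tri
h' t i j = t i (suc i ∸ j)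

_≈[_]_ : Tri → ℕ → Tri → Set
s ≈[ n ] t = ∀ i j → 1 ≤ j → j ≤ i → i ≤ n → s i j ≡ t i j

InHPT : ℕ → Tri → Set
InHPT n t = IsPT n t × (h' t ≈[ n ] t)

zeroT : Tri
zeroT i j = false

linComb : ∀ {m} → (Fin m → Bool) → (Fin m → Tri) → Tri
linComb {zero}  c b i j = false
linComb {suc m} c b i j =
  (c zero ∧ b zero i j) xor linComb (λ k → c (suc k)) (λ k → b (suc k)) i j

IsBasisHPT : (n : ℕ) → ∀ {m} → (Fin m → Tri) → Set
IsBasisHPT n {m} b =
  (∀ k → InHPT n (b k)) ×
  (∀ (c : Fin m → Bool) → linComb c b ≈[ n ] zeroT → ∀ k → c k ≡ false) ×
  (∀ t → InHPT n t → ∃ λ (c : Fin m → Bool) → t ≈[ n ] linComb c b)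

gB : ℕ → ℕ → Tri
gB n k = γ n (nabla (B ((2 ℕ.* (n ∸ k)) ∸ 1) ((2 ℕ.* n) ∸ 1) (ℤ.- (+ k))))

gOne : ℕ → Tri
gOne n = γ n (nabla (const true ((2 ℕ.* n) ∸ 1)))

family : (n : ℕ) → Fin n → Tri
family (suc n') zero    = gOne (suc n')
family (suc n') (suc m) = gB (suc n') (suc (toℕ m))

oneZeros : ℕ → Bool
oneZeros i = i ≡ᵇ 1

module Submission where

-- 1. Binomial coefficients mod 2 on ℤ × ℤ satisfy Pascal's rule everywhere and the
--    reflection binom(x,b) ≡ binom(b-1-x,b) of the upper index.
-- 2. By Pascal's rule the Steinhaus triangle over B^K_{N,l} has entries
--    binom(l+j-i, K+1-i) mod 2; this is the closed formula for γ(∇B), and the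
--    reflection identity shows that γ(∇B) is symmetric, hence lies in HPT(n).
--    Its left side vanishes in rows 1..n-k and is 1 in row n-k+1, while
--    γ(∇(1)_{2n-1}) has both sides equal to (1)·(0)_{n-1}.
-- 3. A generalized Pascal triangle is determined by its two sides, so an element of
--    HPT(n) is determined by its left side.  Hence a family in HPT(n) whose left
--    sides are in echelon form, with pivot rows running bijectively over 1..n, is a
--    basis (elimination from the top row down).  The family of the theorem has the
--    pivot rows 1 and n-k+1, and the theorem follows.

open import Defs
open import Data.Bool using (Bool; true; false; _xor_; _∧_; not)
open import Data.Bool.Properties
  using (not-involutive; not-distribˡ-xor; xor-assoc; xor-same; xor-identityʳ;
         ∧-zeroʳ; ∧-identityʳ; xor-∧-commutativeRing)
open import Data.Nat as ℕ using (ℕ; zero; suc; _∸_; _≤_; _<_; _≡ᵇ_; s≤s; z≤n; _*_)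
open import Data.Nat.Properties as ℕP using ()
open import Data.Nat.DivMod using (_%_)
open import Data.Nat.Combinatorics using (_C_; nCn≡1; k>n⇒nCk≡0; nCk+nC[k+1]≡[n+1]C[k+1])
open import Data.Integer as ℤ using (ℤ; +_; -[1+_]; ∣_∣)
open import Data.Integer.Properties as ℤP using ()
open import Data.Integer.Tactic.RingSolver using (solve-∀)
open import Data.Fin using (Fin; zero; suc; toℕ; fromℕ<)
open import Data.Fin.Properties as FinP using ()
open import Data.Vec.Functional using (updateAt)
open import Data.Sum using (inj₁; inj₂)
open import Data.Product using (_×_; _,_; ∃; proj₁; proj₂)
open import Relation.Binary.Definitions using (tri<; tri≈; tri>)
open import Relation.Nullary using (¬_; contradiction)
open import Relation.Binary.PropositionalEquality
open ≡-Reasoning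
open import Algebra.Bundles using (CommutativeRing)
open import Algebra.Properties.CommutativeSemigroup
  (CommutativeRing.+-commutativeSemigroup xor-∧-commutativeRing)
  using (interchange; x∙yz≈y∙xz)

xor-cancelˡ : ∀ x y → x xor (x xor y) ≡ y
xor-cancelˡ x y = trans (sym (xor-assoc x x y)) (cong (_xor y) (xor-same x))

xor-cancelʳ : ∀ x y → y xor (x xor y) ≡ x
xor-cancelʳ x y = trans (x∙yz≈y∙xz y x y) (trans (cong (x xor_) (xor-same y)) (xor-identityʳ x))

odd : ℕ → Bool
odd zero    = false
odd (suc n) = not (odd n)

odd-correct : ∀ n → (n % 2 ≡ᵇ 1) ≡ odd n
odd-correct zero          = refl
odd-correct (suc zero)    = refl
odd-correct (suc (suc n)) = trans (odd-correct n) (sym (not-involutive (odd n)))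

odd-+ : ∀ a b → odd (a ℕ.+ b) ≡ odd a xor odd b
odd-+ zero    b = refl
odd-+ (suc a) b = trans (cong not (odd-+ a b)) (not-distribˡ-xor (odd a) (odd b))

binom2-pos : ∀ a b → binom2 (+ a) (+ b) ≡ odd (a C b)
binom2-pos a b = odd-correct (a C b)

binom2-neg : ∀ a b → binom2 -[1+ a ] (+ b) ≡ odd ((a ℕ.+ b) C b)
binom2-neg a b = trans (cong (λ m → (m % 2) ≡ᵇ 1) ∣sign*c∣) (odd-correct ((a ℕ.+ b) C b))
  where
  ∣-1^e∣ : ∀ e → ∣ (ℤ.- (+ 1)) ℤ.^ e ∣ ≡ 1
  ∣-1^e∣ zero    = refl
  ∣-1^e∣ (suc e) = trans (ℤP.abs-* (ℤ.- (+ 1)) ((ℤ.- (+ 1)) ℤ.^ e)) (cong (1 *_) (∣-1^e∣ e))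
  ∣sign*c∣ : ∣ (ℤ.- (+ 1)) ℤ.^ b ℤ.* + ((a ℕ.+ b) C b) ∣ ≡ (a ℕ.+ b) C b
  ∣sign*c∣ = trans (ℤP.abs-* ((ℤ.- (+ 1)) ℤ.^ b) _)
                     (trans (cong (_* ((a ℕ.+ b) C b)) (∣-1^e∣ b)) (ℕP.*-identityˡ _))

binom2-zero : ∀ X → binom2 X (+ 0) ≡ true
binom2-zero (+ a)    = refl
binom2-zero -[1+ a ] = refl

binom2-minus-one : ∀ b → binom2 -[1+ 0 ] (+ b) ≡ true
binom2-minus-one b = trans (binom2-neg 0 b) (cong odd (nCn≡1 b))

binom2-vanish : ∀ {d b} → d < b → binom2 (+ d) (+ b) ≡ false
binom2-vanish {d} {b} d<b = trans (binom2-pos d b) (cong odd (k>n⇒nCk≡0 d<b))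

binom2-pascal : ∀ X Y → binom2 (+ 1 ℤ.+ X) (+ 1 ℤ.+ Y) ≡ binom2 X Y xor binom2 X (+ 1 ℤ.+ Y)
binom2-pascal X -[1+ zero ]    = trans (binom2-zero (+ 1 ℤ.+ X)) (sym (binom2-zero X))
binom2-pascal X -[1+ suc b ]   = refl
binom2-pascal (+ a) (+ b)      = begin
  binom2 (+ suc a) (+ suc b)         ≡⟨ binom2-pos (suc a) (suc b) ⟩
  odd (suc a C suc b)                ≡⟨ cong odd (sym (nCk+nC[k+1]≡[n+1]C[k+1] a b)) ⟩
  odd (a C b ℕ.+ a C suc b)          ≡⟨ odd-+ (a C b) (a C suc b) ⟩
  odd (a C b) xor odd (a C suc b)    ≡⟨ sym (cong₂ _xor_ (binom2-pos a b) (binom2-pos a (suc b))) ⟩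
  binom2 (+ a) (+ b) xor binom2 (+ a) (+ suc b) ∎
binom2-pascal -[1+ zero ] (+ b) =
  sym (cong₂ _xor_ (binom2-minus-one b) (binom2-minus-one (suc b)))
binom2-pascal -[1+ suc a ] (+ b) = begin
  binom2 -[1+ a ] (+ suc b)                     ≡⟨ binom2-neg a (suc b) ⟩
  odd ((a ℕ.+ suc b) C suc b)                   ≡⟨ cong (λ m → odd (m C suc b)) (ℕP.+-suc a b) ⟩
  odd (c C suc b)                               ≡⟨ sym (xor-cancelˡ (odd (c C b)) _) ⟩
  odd (c C b) xor (odd (c C b) xor odd (c C suc b))
    ≡⟨ cong (odd (c C b) xor_) (sym (odd-+ (c C b) (c C suc b))) ⟩
  odd (c C b) xor odd (c C b ℕ.+ c C suc b)
    ≡⟨ cong (λ m → odd (c C b) xor odd m) (nCk+nC[k+1]≡[n+1]C[k+1] c b) ⟩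
  odd (c C b) xor odd (suc c C suc b)
    ≡⟨ cong (λ m → odd (c C b) xor odd (suc m C suc b)) (sym (ℕP.+-suc a b)) ⟩
  odd (c C b) xor odd ((suc a ℕ.+ suc b) C suc b)
    ≡⟨ sym (cong₂ _xor_ (binom2-neg (suc a) b) (binom2-neg (suc a) (suc b))) ⟩
  binom2 -[1+ suc a ] (+ b) xor binom2 -[1+ suc a ] (+ suc b) ∎
  where
  c : ℕ
  c = suc a ℕ.+ b

-- Reflection of the upper index, binom(x,b) ≡ binom(b-1-x,b) (mod 2), first for
-- 0 ≤ b ≤ x = b+d, where it is C(b+d,b) = |binom(-1-d,b)| ...
binom2-reflect-≥ : ∀ {a b} → b ≤ a → binom2 (+ a) (+ b) ≡ binom2 ((+ b ℤ.- + 1) ℤ.- + a) (+ b)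
binom2-reflect-≥ {a} {b} b≤a with ℕP.m≤n⇒∃[o]m+o≡n b≤a
... | d , refl = begin
  binom2 (+ (b ℕ.+ d)) (+ b)      ≡⟨ binom2-pos (b ℕ.+ d) b ⟩
  odd ((b ℕ.+ d) C b)             ≡⟨ cong (λ m → odd (m C b)) (ℕP.+-comm b d) ⟩
  odd ((d ℕ.+ b) C b)             ≡⟨ sym (binom2-neg d b) ⟩
  binom2 -[1+ d ] (+ b)           ≡⟨ cong (λ Z → binom2 Z (+ b)) (sym upper) ⟩
  binom2 ((+ b ℤ.- + 1) ℤ.- + (b ℕ.+ d)) (+ b) ∎
  where
  ring : ∀ B D → (B ℤ.- + 1) ℤ.- (B ℤ.+ D) ≡ ℤ.- (+ 1 ℤ.+ D)
  ring = solve-∀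
  upper : (+ b ℤ.- + 1) ℤ.- + (b ℕ.+ d) ≡ -[1+ d ]
  upper = trans (cong (λ Z → (+ b ℤ.- + 1) ℤ.- Z) (ℤP.pos-+ b d)) (ring (+ b) (+ d))

-- ... then for 0 ≤ x < b, where both sides vanish ...
binom2-reflect-< : ∀ {a b} → a < b → binom2 (+ a) (+ b) ≡ binom2 ((+ b ℤ.- + 1) ℤ.- + a) (+ b)
binom2-reflect-< {a} a<b with ℕP.m≤n⇒∃[o]m+o≡n a<b
... | d , refl = begin
  binom2 (+ a) (+ suc (a ℕ.+ d))    ≡⟨ binom2-vanish (s≤s (ℕP.m≤m+n a d)) ⟩
  false                             ≡⟨ sym (binom2-vanish (s≤s (ℕP.m≤n+m d a))) ⟩
  binom2 (+ d) (+ suc (a ℕ.+ d))    ≡⟨ cong (λ Z → binom2 Z (+ suc (a ℕ.+ d))) (sym upper) ⟩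
  binom2 ((+ suc (a ℕ.+ d) ℤ.- + 1) ℤ.- + a) (+ suc (a ℕ.+ d)) ∎
  where
  ring : ∀ A D → ((+ 1 ℤ.+ (A ℤ.+ D)) ℤ.- + 1) ℤ.- A ≡ D
  ring = solve-∀
  upper : (+ suc (a ℕ.+ d) ℤ.- + 1) ℤ.- + a ≡ + d
  upper = trans (cong (λ Z → (+ 1 ℤ.+ Z ℤ.- + 1) ℤ.- + a) (ℤP.pos-+ a d)) (ring (+ a) (+ d))

-- ... and in general (for x < 0 it is the first case read backwards, for b < 0
-- both sides are 0).
binom2-reflect : ∀ X Y → binom2 X Y ≡ binom2 ((Y ℤ.- + 1) ℤ.- X) Y
binom2-reflect X       -[1+ m ] = refl
binom2-reflect (+ a)    (+ b) with ℕP.≤-<-connex b a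
... | inj₁ b≤a = binom2-reflect-≥ b≤a
... | inj₂ a<b = binom2-reflect-< a<b
binom2-reflect -[1+ a ] (+ b) = begin
  binom2 -[1+ a ] (+ b)         ≡⟨ binom2-neg a b ⟩
  odd ((a ℕ.+ b) C b)           ≡⟨ cong (λ m → odd (m C b)) (ℕP.+-comm a b) ⟩
  odd ((b ℕ.+ a) C b)           ≡⟨ sym (binom2-pos (b ℕ.+ a) b) ⟩
  binom2 (+ (b ℕ.+ a)) (+ b)    ≡⟨ cong (λ Z → binom2 Z (+ b)) (sym upper) ⟩
  binom2 ((+ b ℤ.- + 1) ℤ.- -[1+ a ]) (+ b) ∎
  where
  ring : ∀ B A → (B ℤ.- + 1) ℤ.- ℤ.- (+ 1 ℤ.+ A) ≡ B ℤ.+ A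
  ring = solve-∀
  upper : (+ b ℤ.- + 1) ℤ.- -[1+ a ] ≡ + (b ℕ.+ a)
  upper = trans (ring (+ b) (+ a)) (sym (ℤP.pos-+ b a))

binom2-reflect-sum : ∀ X Y B → X ℤ.+ Y ≡ B ℤ.- + 1 → binom2 X B ≡ binom2 Y B
binom2-reflect-sum X Y B sum = trans (binom2-reflect X B) (cong (λ Z → binom2 Z B) partner)
  where
  ring : ∀ X Y → (X ℤ.+ Y) ℤ.- X ≡ Y
  ring = solve-∀
  partner : (B ℤ.- + 1) ℤ.- X ≡ Y
  partner = trans (cong (λ Z → Z ℤ.- X) (sym sum)) (ring X Y)

pos-∸ : ∀ {m n} → n ≤ m → + (m ∸ n) ≡ + m ℤ.- + n
pos-∸ {m} {n} n≤m = sym (trans (ℤP.m-n≡m⊖n m n) (ℤP.⊖-≥ n≤m))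

-- Closed form of the Steinhaus triangle over B^K_{N,l}: for 1 ≤ i ≤ j+1 its entry
-- (i,j) is binom(l+j-i, K+1-i) mod 2.  Row 1 is the definition of B, and each
-- further row follows from the row above by Pascal's rule.
nabla-B : ∀ K N l i j → 1 ≤ i → i ≤ suc j →
  nabla (B K N l) i j ≡ binom2 ((l ℤ.+ + j) ℤ.- + i) ((+ K ℤ.+ + 1) ℤ.- + i)
nabla-B K N l (suc zero) j _ _ = cong (binom2 ((l ℤ.+ + j) ℤ.- + 1)) (sym (ring (+ K)))
  where
  ring : ∀ K → (K ℤ.+ + 1) ℤ.- + 1 ≡ K
  ring = solve-∀
nabla-B K N l (suc (suc m)) zero _ (s≤s ())
nabla-B K N l (suc (suc m)) (suc j) _ (s≤s i≤j) = begin
  nabla (B K N l) (suc m) j xor nabla (B K N l) (suc m) (suc j)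
    ≡⟨ cong₂ _xor_ (nabla-B K N l (suc m) j (s≤s z≤n) i≤j)
                   (nabla-B K N l (suc m) (suc j) (s≤s z≤n) (ℕP.m≤n⇒m≤1+n i≤j)) ⟩
  binom2 X (K₁ ℤ.- + suc m) xor binom2 ((l ℤ.+ + suc j) ℤ.- + suc m) (K₁ ℤ.- + suc m)
    ≡⟨ cong₂ (λ u v → binom2 X u xor binom2 v u) (lower-shift K₁ (+ m)) (upper-shift l (+ j) (+ m)) ⟩
  binom2 X (+ 1 ℤ.+ Y) xor binom2 (+ 1 ℤ.+ X) (+ 1 ℤ.+ Y)
    ≡⟨ cong (binom2 X (+ 1 ℤ.+ Y) xor_) (binom2-pascal X Y) ⟩
  binom2 X (+ 1 ℤ.+ Y) xor (binom2 X Y xor binom2 X (+ 1 ℤ.+ Y))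
    ≡⟨ xor-cancelʳ (binom2 X Y) (binom2 X (+ 1 ℤ.+ Y)) ⟩
  binom2 X Y
    ≡⟨ cong (λ u → binom2 u Y) (diagonal-shift l (+ j) (+ m)) ⟩
  binom2 ((l ℤ.+ + suc j) ℤ.- + suc (suc m)) Y ∎
  where
  K₁ X Y : ℤ
  K₁ = + K ℤ.+ + 1
  X  = (l ℤ.+ + j) ℤ.- + suc m
  Y  = K₁ ℤ.- + suc (suc m)
  lower-shift : ∀ K M → K ℤ.- (+ 1 ℤ.+ M) ≡ + 1 ℤ.+ (K ℤ.- (+ 1 ℤ.+ (+ 1 ℤ.+ M)))
  lower-shift = solve-∀
  upper-shift : ∀ L J M → (L ℤ.+ (+ 1 ℤ.+ J)) ℤ.- (+ 1 ℤ.+ M) ≡ + 1 ℤ.+ ((L ℤ.+ J) ℤ.- (+ 1 ℤ.+ M))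
  upper-shift = solve-∀
  diagonal-shift : ∀ L J M → (L ℤ.+ J) ℤ.- (+ 1 ℤ.+ M) ≡ (L ℤ.+ (+ 1 ℤ.+ J)) ℤ.- (+ 1 ℤ.+ (+ 1 ℤ.+ M))
  diagonal-shift = solve-∀

γ-nabla-isPT : ∀ n S → IsPT n (γ n (nabla S))
γ-nabla-isPT n S (suc (suc m)) (suc j) _ _ _ =
  cong (λ c → nabla S (suc m) (c ∸ 1) xor nabla S (suc m) ((n ∸ 1) ℕ.+ suc j)) (ℕP.+-suc (n ∸ 1) j)
γ-nabla-isPT n S (suc zero) (suc (suc j)) _ (s≤s ()) _

gB-formula : ∀ n k → k < n → ∀ i j → 1 ≤ j → j ≤ i → i ≤ n →
  gB n k i j ≡ binom2 ((((ℤ.- (+ k)) ℤ.+ + j) ℤ.- + i) ℤ.+ (+ n ℤ.- + 1))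
                      ((+ (2 * (n ∸ k))) ℤ.- + i)
gB-formula (suc n') k k<n i j 1≤j j≤i i≤n =
  trans (nabla-B K N l i (n' ℕ.+ j) (ℕP.≤-trans 1≤j j≤i) (ℕP.≤-trans i≤n (s≤s (ℕP.m≤m+n n' j))))
        (cong₂ binom2 (shift l (+ n') (+ j) (+ i)) (cong (λ z → + z ℤ.- + i) (ℕP.m∸n+n≡m 1≤2[n-k])))
  where
  K N : ℕ
  K = 2 * (suc n' ∸ k) ∸ 1
  N = 2 * suc n' ∸ 1
  l : ℤ
  l = ℤ.- (+ k)
  1≤2[n-k] : 1 ≤ 2 * (suc n' ∸ k)
  1≤2[n-k] = ℕP.≤-trans (ℕP.m<n⇒0<n∸m k<n) (ℕP.m≤m+n (suc n' ∸ k) _)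
  shift : ∀ L M J I → (L ℤ.+ (M ℤ.+ J)) ℤ.- I ≡ ((L ℤ.+ J) ℤ.- I) ℤ.+ ((+ 1 ℤ.+ M) ℤ.- + 1)
  shift = solve-∀

-- γ(∇B^{2(n-k)-1}_{2n-1,-k}) is symmetric: by the closed formula, entries (i,j) and
-- (i,i+1-j) have upper indices summing to 2(n-k)-i-1, so the reflection identity applies.
gB-symmetric : ∀ n k → k < n → h' (gB n k) ≈[ n ] gB n k
gB-symmetric n k k<n i j 1≤j j≤i i≤n = begin
  gB n k i (suc i ∸ j)  ≡⟨ gB-formula n k k<n i (suc i ∸ j) 1≤j′ j′≤i i≤n ⟩
  binom2 X′ Y           ≡⟨ binom2-reflect-sum X′ X Y upper-sum ⟩
  binom2 X Y            ≡⟨ sym (gB-formula n k k<n i j 1≤j j≤i i≤n) ⟩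
  gB n k i j ∎
  where
  X′ X Y : ℤ
  X′ = (((ℤ.- (+ k)) ℤ.+ + (suc i ∸ j)) ℤ.- + i) ℤ.+ (+ n ℤ.- + 1)
  X  = (((ℤ.- (+ k)) ℤ.+ + j) ℤ.- + i) ℤ.+ (+ n ℤ.- + 1)
  Y  = (+ (2 * (n ∸ k))) ℤ.- + i
  1≤j′ : 1 ≤ suc i ∸ j
  1≤j′ = ℕP.m<n⇒0<n∸m (s≤s j≤i)
  j′≤i : suc i ∸ j ≤ i
  j′≤i = ℕP.∸-monoʳ-≤ (suc i) 1≤j
  ring : ∀ K I J N → (((ℤ.- K ℤ.+ ((+ 1 ℤ.+ I) ℤ.- J)) ℤ.- I) ℤ.+ (N ℤ.- + 1))
                     ℤ.+ (((ℤ.- K ℤ.+ J) ℤ.- I) ℤ.+ (N ℤ.- + 1))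
                   ≡ (((N ℤ.- K) ℤ.+ ((N ℤ.- K) ℤ.+ + 0)) ℤ.- I) ℤ.- + 1
  ring = solve-∀
  upper-sum : X′ ℤ.+ X ≡ Y ℤ.- + 1
  upper-sum = begin
    X′ ℤ.+ X
      ≡⟨ cong (λ D → (((ℤ.- (+ k) ℤ.+ D) ℤ.- + i) ℤ.+ (+ n ℤ.- + 1)) ℤ.+ X)
              (pos-∸ (ℕP.m≤n⇒m≤1+n j≤i)) ⟩
    (((ℤ.- (+ k) ℤ.+ (+ suc i ℤ.- + j)) ℤ.- + i) ℤ.+ (+ n ℤ.- + 1)) ℤ.+ X
      ≡⟨ ring (+ k) (+ i) (+ j) (+ n) ⟩
    (((+ n ℤ.- + k) ℤ.+ ((+ n ℤ.- + k) ℤ.+ + 0)) ℤ.- + i) ℤ.- + 1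
      ≡⟨ cong (λ E → ((E ℤ.+ (E ℤ.+ + 0)) ℤ.- + i) ℤ.- + 1) (sym (pos-∸ (ℕP.<⇒≤ k<n))) ⟩
    Y ℤ.- + 1 ∎

-- ∇(1)_N has the all-ones first row and zero rows below, so both sides of
-- γ(∇(1)_{2n-1}) are (1)·(0)_{n-1} and it is symmetric.
nabla-ones : ∀ N i j → 1 ≤ i → nabla (const true N) i j ≡ oneZeros i
nabla-ones N (suc zero)          j _ = refl
nabla-ones N (suc (suc zero))    j _ = refl
nabla-ones N (suc (suc (suc m))) j _ =
  cong₂ _xor_ (nabla-ones N (suc (suc m)) (j ∸ 1) (s≤s z≤n)) (nabla-ones N (suc (suc m)) j (s≤s z≤n))

gOne-entry : ∀ n i j → 1 ≤ i → gOne n i j ≡ oneZeros i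
gOne-entry n i j = nabla-ones (2 * n ∸ 1) i ((n ∸ 1) ℕ.+ j)

gOne-symmetric : ∀ n → h' (gOne n) ≈[ n ] gOne n
gOne-symmetric n i j 1≤j j≤i _ =
  trans (gOne-entry n i (suc i ∸ j) 1≤i) (sym (gOne-entry n i j 1≤i))
  where
  1≤i : 1 ≤ i
  1≤i = ℕP.≤-trans 1≤j j≤i

-- The left side of γ(∇B^{2(n-k)-1}_{2n-1,-k}) is 1 in row n-k+1: the entry is
-- binom(-1, n-k-1) ...
gB-pivot : ∀ n k → 1 ≤ k → k < n → gB n k (suc (n ∸ k)) 1 ≡ true
gB-pivot n k 1≤k k<n = begin
  gB n k (suc x) 1
    ≡⟨ gB-formula n k k<n (suc x) 1 (s≤s z≤n) (s≤s z≤n) (ℕP.∸-monoʳ-< 1≤k (ℕP.<⇒≤ k<n)) ⟩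
  binom2 ((((ℤ.- (+ k)) ℤ.+ + 1) ℤ.- + suc x) ℤ.+ (+ n ℤ.- + 1)) (+ (2 * x) ℤ.- + suc x)
    ≡⟨ cong₂ binom2 upper (lower x (ℕP.m<n⇒0<n∸m k<n)) ⟩
  binom2 -[1+ 0 ] (+ (x ∸ 1))
    ≡⟨ binom2-minus-one (x ∸ 1) ⟩
  true ∎
  where
  x : ℕ
  x = n ∸ k
  ring-upper : ∀ K N → ((ℤ.- K ℤ.+ + 1) ℤ.- (+ 1 ℤ.+ (N ℤ.- K))) ℤ.+ (N ℤ.- + 1) ≡ ℤ.- (+ 1)
  ring-upper = solve-∀
  upper : (((ℤ.- (+ k)) ℤ.+ + 1) ℤ.- + suc x) ℤ.+ (+ n ℤ.- + 1) ≡ -[1+ 0 ]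
  upper = trans (cong (λ E → ((ℤ.- (+ k) ℤ.+ + 1) ℤ.- (+ 1 ℤ.+ E)) ℤ.+ (+ n ℤ.- + 1)) (pos-∸ (ℕP.<⇒≤ k<n)))
                (ring-upper (+ k) (+ n))
  ring-lower : ∀ R → ((+ 1 ℤ.+ R) ℤ.+ ((+ 1 ℤ.+ R) ℤ.+ + 0)) ℤ.- (+ 1 ℤ.+ (+ 1 ℤ.+ R)) ≡ R
  ring-lower = solve-∀
  lower : ∀ y → 1 ≤ y → + (2 * y) ℤ.- + suc y ≡ + (y ∸ 1)
  lower (suc r) _ = ring-lower (+ r)

-- ... and 0 in rows i ≤ n-k, where the entry is binom(n-k-i, 2(n-k)-i) with upper
-- index below the lower one.
gB-above-pivot : ∀ n k → k < n → ∀ i → 1 ≤ i → i ≤ n ∸ k → gB n k i 1 ≡ false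
gB-above-pivot n k k<n i 1≤i i≤x = begin
  gB n k i 1
    ≡⟨ gB-formula n k k<n i 1 (s≤s z≤n) 1≤i (ℕP.≤-trans i≤x (ℕP.m∸n≤m n k)) ⟩
  binom2 ((((ℤ.- (+ k)) ℤ.+ + 1) ℤ.- + i) ℤ.+ (+ n ℤ.- + 1)) (+ (2 * x) ℤ.- + i)
    ≡⟨ cong₂ binom2 upper lower ⟩
  binom2 (+ (x ∸ i)) (+ ((x ∸ i) ℕ.+ x))
    ≡⟨ binom2-vanish (ℕP.m<m+n (x ∸ i) (ℕP.≤-trans 1≤i i≤x)) ⟩
  false ∎
  where
  x : ℕ
  x = n ∸ k
  ring-upper : ∀ K N I → ((ℤ.- K ℤ.+ + 1) ℤ.- I) ℤ.+ (N ℤ.- + 1) ≡ (N ℤ.- K) ℤ.- I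
  ring-upper = solve-∀
  ring-lower : ∀ X I → (X ℤ.+ (X ℤ.+ + 0)) ℤ.- I ≡ (X ℤ.- I) ℤ.+ X
  ring-lower = solve-∀
  upper : (((ℤ.- (+ k)) ℤ.+ + 1) ℤ.- + i) ℤ.+ (+ n ℤ.- + 1) ≡ + (x ∸ i)
  upper = begin
    ((ℤ.- (+ k) ℤ.+ + 1) ℤ.- + i) ℤ.+ (+ n ℤ.- + 1) ≡⟨ ring-upper (+ k) (+ n) (+ i) ⟩
    (+ n ℤ.- + k) ℤ.- + i                            ≡⟨ cong (λ E → E ℤ.- + i) (sym (pos-∸ (ℕP.<⇒≤ k<n))) ⟩
    + x ℤ.- + i                                      ≡⟨ sym (pos-∸ i≤x) ⟩
    + (x ∸ i) ∎
  lower : + (2 * x) ℤ.- + i ≡ + ((x ∸ i) ℕ.+ x)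
  lower = trans (ring-lower (+ x) (+ i)) (cong (ℤ._+ + x) (sym (pos-∸ i≤x)))

linComb-zero : ∀ {m} (b : Fin m → Tri) i j → linComb (λ _ → false) b i j ≡ false
linComb-zero {zero}  b i j = refl
linComb-zero {suc m} b i j = linComb-zero (λ k → b (suc k)) i j

linComb-flip : ∀ {m} (c : Fin m → Bool) (b : Fin m → Tri) q i j →
  linComb (updateAt c q not) b i j ≡ b q i j xor linComb c b i j
linComb-flip c b zero i j =
  trans (cong (_xor linComb (λ k → c (suc k)) (λ k → b (suc k)) i j) (not-∧ (c zero) (b zero i j)))
        (xor-assoc (b zero i j) (c zero ∧ b zero i j) _)
  where
  not-∧ : ∀ c x → not c ∧ x ≡ x xor (c ∧ x)
  not-∧ false x = sym (xor-identityʳ x)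
  not-∧ true  x = sym (xor-same x)
linComb-flip c b (suc q) i j =
  trans (cong ((c zero ∧ b zero i j) xor_) (linComb-flip (λ k → c (suc k)) (λ k → b (suc k)) q i j))
        (x∙yz≈y∙xz (c zero ∧ b zero i j) (b (suc q) i j) _)

linComb-vanish : ∀ {m} (c : Fin m → Bool) (b : Fin m → Tri) i j →
  (∀ k → (c k ∧ b k i j) ≡ false) → linComb c b i j ≡ false
linComb-vanish {zero}  c b i j _ = refl
linComb-vanish {suc m} c b i j terms =
  cong₂ _xor_ (terms zero) (linComb-vanish (λ k → c (suc k)) (λ k → b (suc k)) i j (λ k → terms (suc k)))

linComb-single : ∀ {m} (c : Fin m → Bool) (b : Fin m → Tri) q i j →
  (∀ k → ¬ k ≡ q → (c k ∧ b k i j) ≡ false) → linComb c b i j ≡ (c q ∧ b q i j)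
linComb-single c b zero i j others =
  trans (cong ((c zero ∧ b zero i j) xor_)
              (linComb-vanish (λ k → c (suc k)) (λ k → b (suc k)) i j (λ k → others (suc k) λ ())))
        (xor-identityʳ _)
linComb-single c b (suc q) i j others =
  cong₂ _xor_ (others zero λ ())
              (linComb-single (λ k → c (suc k)) (λ k → b (suc k)) q i j
                              (λ k k≢q → others (suc k) (λ e → k≢q (FinP.suc-injective e))))

_⊕_ : Tri → Tri → Tri
(s ⊕ t) i j = s i j xor t i j

⊕-InHPT : ∀ n s t → InHPT n s → InHPT n t → InHPT n (s ⊕ t)
⊕-InHPT n s t (s-pt , s-sym) (t-pt , t-sym) = pt , sym′
  where
  pt : IsPT n (s ⊕ t)
  pt i j 2≤j j<i i≤n =
    trans (cong₂ _xor_ (s-pt i j 2≤j j<i i≤n) (t-pt i j 2≤j j<i i≤n))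
          (interchange (s (i ∸ 1) (j ∸ 1)) (s (i ∸ 1) j) (t (i ∸ 1) (j ∸ 1)) (t (i ∸ 1) j))
  sym′ : h' (s ⊕ t) ≈[ n ] (s ⊕ t)
  sym′ i j 1≤j j≤i i≤n = cong₂ _xor_ (s-sym i j 1≤j j≤i i≤n) (t-sym i j 1≤j j≤i i≤n)

PT-sides-zero : ∀ n t → IsPT n t →
  (∀ i → 1 ≤ i → i ≤ n → t i 1 ≡ false) → (∀ i → 1 ≤ i → i ≤ n → t i i ≡ false) →
  t ≈[ n ] zeroT
PT-sides-zero n t pt left right = entry
  where
  entry : ∀ i j → 1 ≤ j → j ≤ i → i ≤ n → t i j ≡ false
  entry (suc i) (suc zero) _ _ i≤n = left (suc i) (s≤s z≤n) i≤n
  entry (suc i) (suc (suc j)) _ j<i i≤n with ℕP.m≤n⇒m<n∨m≡n j<i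
  ... | inj₂ refl = right (suc i) (s≤s z≤n) i≤n
  ... | inj₁ (s≤s j+1<i) =
    trans (pt (suc i) (suc (suc j)) (s≤s (s≤s z≤n)) (s≤s j+1<i) i≤n)
          (cong₂ _xor_ (entry i (suc j) (s≤s z≤n) (ℕP.<⇒≤ j+1<i) i≤n′)
                       (entry i (suc (suc j)) (s≤s z≤n) j+1<i i≤n′))
    where
    i≤n′ : i ≤ n
    i≤n′ = ℕP.≤-trans (ℕP.n≤1+n i) i≤n

-- In HPT(n) the right side mirrors the left side, so the left side alone
-- determines the triangle.
HPT-left-zero : ∀ n t → InHPT n t → (∀ i → 1 ≤ i → i ≤ n → t i 1 ≡ false) → t ≈[ n ] zeroT
HPT-left-zero n t (pt , symm) left = PT-sides-zero n t pt left right
  where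
  right : ∀ i → 1 ≤ i → i ≤ n → t i i ≡ false
  right i 1≤i i≤n = trans (symm i 1 (s≤s z≤n) 1≤i i≤n) (left i 1≤i i≤n)

module EchelonBasis
  (n : ℕ) {m : ℕ} (b : Fin m → Tri) (pivot : Fin m → ℕ)
  (b-InHPT          : ∀ q → InHPT n (b q))
  (pivot-one        : ∀ q → b q (pivot q) 1 ≡ true)
  (above-pivot-zero : ∀ q i → 1 ≤ i → i < pivot q → b q i 1 ≡ false)
  (pivot-positive   : ∀ q → 1 ≤ pivot q)
  (pivot-bounded    : ∀ q → pivot q ≤ n)
  (pivot-injective  : ∀ q q′ → pivot q ≡ pivot q′ → q ≡ q′)
  (pivot-onto       : ∀ s → 1 ≤ s → s ≤ n → ∃ λ q → pivot q ≡ s)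
  where

  ZeroAbove : Tri → ℕ → Set
  ZeroAbove t s = ∀ i → 1 ≤ i → i < s → t i 1 ≡ false

  zeroAbove-extend : ∀ t {s} → ZeroAbove t s → t s 1 ≡ false → ZeroAbove t (suc s)
  zeroAbove-extend t zero-above ts i 1≤i (s≤s i≤s) with ℕP.m≤n⇒m<n∨m≡n i≤s
  ... | inj₁ i<s  = zero-above i 1≤i i<s
  ... | inj₂ refl = ts

  Spanned : Tri → Set
  Spanned t = ∃ λ (c : Fin m → Bool) → t ≈[ n ] linComb c b

  spanned-⊕ : ∀ t q → Spanned (t ⊕ b q) → Spanned t
  spanned-⊕ t q (c , t⊕bq≈) = updateAt c q not , λ i j 1≤j j≤i i≤n → begin
    t i j                               ≡⟨ sym (xor-cancelʳ (t i j) (b q i j)) ⟩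
    b q i j xor (t i j xor b q i j)     ≡⟨ cong (b q i j xor_) (t⊕bq≈ i j 1≤j j≤i i≤n) ⟩
    b q i j xor linComb c b i j         ≡⟨ sym (linComb-flip c b q i j) ⟩
    linComb (updateAt c q not) b i j    ∎

  -- If row
  -- s+1 of the left side is 1, adding the member with pivot row s+1 clears it.
  spanned-from : ∀ d s → d ℕ.+ suc s ≡ suc n → ∀ t → InHPT n t → ZeroAbove t (suc s) → Spanned t
  spanned-from zero s refl t t∈ zero-above =
    (λ _ → false) , λ i j 1≤j j≤i i≤n →
      trans (HPT-left-zero n t t∈ (λ i 1≤i i≤n → zero-above i 1≤i (s≤s i≤n)) i j 1≤j j≤i i≤n)
            (sym (linComb-zero b i j))
  spanned-from (suc d) s rows t t∈ zero-above with t (suc s) 1 in row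
  ... | false = spanned-from d (suc s) rows′ t t∈ (zeroAbove-extend t zero-above row)
    where
    rows′ : d ℕ.+ suc (suc s) ≡ suc n
    rows′ = trans (ℕP.+-suc d (suc s)) rows
  ... | true = spanned-⊕ t q
      (spanned-from d (suc s) rows′ (t ⊕ b q) (⊕-InHPT n t (b q) t∈ (b-InHPT q))
                    (zeroAbove-extend (t ⊕ b q) zero-above′ row′))
    where
    rows′ : d ℕ.+ suc (suc s) ≡ suc n
    rows′ = trans (ℕP.+-suc d (suc s)) rows
    s+1≤n : suc s ≤ n
    s+1≤n = subst (suc s ≤_) (ℕP.suc-injective rows) (ℕP.m≤n+m (suc s) d)
    q : Fin m
    q = proj₁ (pivot-onto (suc s) (s≤s z≤n) s+1≤n)
    pivot-q : pivot q ≡ suc s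
    pivot-q = proj₂ (pivot-onto (suc s) (s≤s z≤n) s+1≤n)
    zero-above′ : ZeroAbove (t ⊕ b q) (suc s)
    zero-above′ i 1≤i i<s+1 =
      cong₂ _xor_ (zero-above i 1≤i i<s+1) (above-pivot-zero q i 1≤i (subst (i <_) (sym pivot-q) i<s+1))
    row′ : (t ⊕ b q) (suc s) 1 ≡ false
    row′ = cong₂ _xor_ row (subst (λ p → b q p 1 ≡ true) pivot-q (pivot-one q))

  spanning : ∀ t → InHPT n t → Spanned t
  spanning t t∈ = spanned-from n 0 (ℕP.+-comm n 1) t t∈ λ { i (s≤s _) (s≤s ()) }

  -- Independence: if Σ c_q b_q = 0, then c_q = 0 by induction on the pivot row of q,
  -- since at that row only b q can contribute once all lower pivots have c = 0.
  module _ (c : Fin m → Bool) (trivial : linComb c b ≈[ n ] zeroT) where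

    pivot-row-entry : ∀ q → (∀ f → pivot f < pivot q → c f ≡ false) → linComb c b (pivot q) 1 ≡ c q
    pivot-row-entry q lower =
      trans (linComb-single c b q (pivot q) 1 others)
            (trans (cong (c q ∧_) (pivot-one q)) (∧-identityʳ (c q)))
      where
      others : ∀ f → ¬ f ≡ q → (c f ∧ b f (pivot q) 1) ≡ false
      others f f≢q with ℕP.<-cmp (pivot f) (pivot q)
      ... | tri< f<q _ _ = cong (_∧ b f (pivot q) 1) (lower f f<q)
      ... | tri≈ _ f=q _ = contradiction (pivot-injective f q f=q) f≢q
      ... | tri> _ _ q<f =
        trans (cong (c f ∧_) (above-pivot-zero f (pivot q) (pivot-positive q) q<f)) (∧-zeroʳ (c f))

    coefficient-zero-upto : ∀ s q → pivot q ≤ s → c q ≡ false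
    coefficient-zero-upto zero q ≤0 = contradiction (ℕP.≤-trans (pivot-positive q) ≤0) λ ()
    coefficient-zero-upto (suc s) q ≤s+1 with ℕP.m≤n⇒m<n∨m≡n ≤s+1
    ... | inj₁ (s≤s ≤s) = coefficient-zero-upto s q ≤s
    ... | inj₂ pivot-q = begin
      c q                        ≡⟨ sym (pivot-row-entry q lower) ⟩
      linComb c b (pivot q) 1    ≡⟨ trivial (pivot q) 1 (s≤s z≤n) (pivot-positive q) (pivot-bounded q) ⟩
      false                      ∎
      where
      lower : ∀ f → pivot f < pivot q → c f ≡ false
      lower f f<q = coefficient-zero-upto s f (ℕP.≤-pred (subst (pivot f <_) pivot-q f<q))

  independent : ∀ (c : Fin m → Bool) → linComb c b ≈[ n ] zeroT → ∀ q → c q ≡ false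
  independent c trivial q = coefficient-zero-upto c trivial (pivot q) q ℕP.≤-refl

  basis : IsBasisHPT n b
  basis = b-InHPT , independent , spanning

-- The family of the theorem for n = n'+1 satisfies the echelon criterion with pivot
-- row 1 for γ(∇(1)_{2n-1}) and n-k+1 for γ(∇B^{2(n-k)-1}_{2n-1,-k}), k = m+1.
module Family (n' : ℕ) where

  n : ℕ
  n = suc n'

  pivotRow : Fin n → ℕ
  pivotRow zero    = 1
  pivotRow (suc m) = suc (n' ∸ toℕ m)

  k<n : ∀ (m : Fin n') → suc (toℕ m) < n
  k<n m = s≤s (FinP.toℕ<n m)

  family-InHPT : ∀ q → InHPT n (family n q)
  family-InHPT zero    = γ-nabla-isPT n _ , gOne-symmetric n
  family-InHPT (suc m) = γ-nabla-isPT n _ , gB-symmetric n (suc (toℕ m)) (k<n m)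

  pivot-one : ∀ q → family n q (pivotRow q) 1 ≡ true
  pivot-one zero    = refl
  pivot-one (suc m) = gB-pivot n (suc (toℕ m)) (s≤s z≤n) (k<n m)

  above-pivot-zero : ∀ q i → 1 ≤ i → i < pivotRow q → family n q i 1 ≡ false
  above-pivot-zero zero    i (s≤s _) (s≤s ())
  above-pivot-zero (suc m) i 1≤i (s≤s i≤n-k) = gB-above-pivot n (suc (toℕ m)) (k<n m) i 1≤i i≤n-k

  pivot-positive : ∀ q → 1 ≤ pivotRow q
  pivot-positive zero    = s≤s z≤n
  pivot-positive (suc m) = s≤s z≤n

  pivot-bounded : ∀ q → pivotRow q ≤ n
  pivot-bounded zero    = s≤s z≤n
  pivot-bounded (suc m) = s≤s (ℕP.m∸n≤m n' (toℕ m))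

  n'∸m≢0 : ∀ (m : Fin n') → ¬ n' ∸ toℕ m ≡ 0
  n'∸m≢0 m = ℕP.n>0⇒n≢0 (ℕP.m<n⇒0<n∸m (FinP.toℕ<n m))

  pivot-injective : ∀ q q′ → pivotRow q ≡ pivotRow q′ → q ≡ q′
  pivot-injective zero    zero     _  = refl
  pivot-injective zero    (suc m′) eq = contradiction (sym (ℕP.suc-injective eq)) (n'∸m≢0 m′)
  pivot-injective (suc m) zero     eq = contradiction (ℕP.suc-injective eq) (n'∸m≢0 m)
  pivot-injective (suc m) (suc m′) eq =
    cong suc (FinP.toℕ-injective (ℕP.∸-cancelˡ-≡ (FinP.toℕ≤n m) (FinP.toℕ≤n m′) (ℕP.suc-injective eq)))

  pivot-onto : ∀ s → 1 ≤ s → s ≤ n → ∃ λ q → pivotRow q ≡ s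
  pivot-onto (suc zero)    _ _           = zero , refl
  pivot-onto (suc (suc r)) _ (s≤s r<n') =
    suc (fromℕ< n'-r-1<n') , cong suc (trans (cong (n' ∸_) (FinP.toℕ-fromℕ< n'-r-1<n')) (ℕP.m∸[m∸n]≡n r<n'))
    where
    n'-r-1<n' : n' ∸ suc r < n'
    n'-r-1<n' = ℕP.∸-monoʳ-< (s≤s z≤n) r<n'

  basis : IsBasisHPT n (family n)
  basis = EchelonBasis.basis n (family n) pivotRow family-InHPT pivot-one above-pivot-zero
                             pivot-positive pivot-bounded pivot-injective pivot-onto

mainTheorem15 : (n : ℕ) → 1 ≤ n →
    IsBasisHPT n (family n)
    × (∀ k → 1 ≤ k → k ≤ n ∸ 1 → ∀ i j → 1 ≤ j → j ≤ i → i ≤ n →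
         gB n k i j ≡ binom2 ((((ℤ.- (+ k)) ℤ.+ + j) ℤ.- + i) ℤ.+ (+ n ℤ.- + 1))
                             ((+ (2 * (n ∸ k))) ℤ.- + i))
    × (IsPT n (gOne n)
       × (∀ i → 1 ≤ i → i ≤ n → gOne n i 1 ≡ oneZeros i)
       × (∀ i → 1 ≤ i → i ≤ n → gOne n i i ≡ oneZeros i))
mainTheorem15 zero ()
mainTheorem15 (suc n') _ =
  Family.basis n' ,
  (λ k _ k≤n' → gB-formula (suc n') k (s≤s k≤n')) ,
  γ-nabla-isPT (suc n') _ ,
  (λ i 1≤i _ → gOne-entry (suc n') i 1 1≤i) ,
  (λ i 1≤i _ → gOne-entry (suc n') i i 1≤i)
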